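{- For every natural number $n$ there exists a decomposition $[\mathsf{K}^c_n,P]$ of the complete convex geometric graph $\mathsf{K}^c_n$ such that \[\chi'([\mathsf{K}^c_n,P])\geq \frac{n^{2}}{9}-O(n).\]
   Context: $\mathsf{K}^c_n$ denotes the complete geometric graph whose $n$ vertices are points in convex position (the vertices of a convex polygon, e.g. a regular $n$-gon) and whose edges are all $\binom n2$ straight-line segments between them. A decomposition $[G,P]$ of a graph $G$ is a set $P$ of non-empty induced subgraphs of $G$ such that every edge of $G$ belongs to exactly one member of $P$; for $G=\mathsf{K}^c_n$ the members of $P$ are complete geometric subgraphs. Two geometric graphs have nonempty intersection if they share a vertex or some edge of one crosses some edge of the other. A $k$-$P$-coloring assigns to each edge one of $k$ colors so that all edges of each member of $P$ get the same color and any two members of $P$ with nonempty intersection get different colors; the chromatic index $\chi'([\mathsf{K}^c_n,P])$ is the least such $k$. -}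

module Defs where

open import Data.Nat using (ℕ; _≤_)
open import Data.Fin using (Fin; _<_)
open import Data.Fin.Subset using (Subset; _∈_; ∣_∣)
open import Data.Product using (Σ; ∃; _×_; _,_)
open import Data.Sum using (_⊎_)
open import Relation.Binary.PropositionalEquality using (_≡_; _≢_)

-- Vertices of K^c_n are 0,…,n-1 in cyclic (convex) order.
-- An edge is a pair (a , b) with a < b.
-- Two edges ab (a<b) and cd (c<d) cross iff their endpoints interleave
-- in the cyclic order of the convex polygon.
Cross : ∀ {n} → Fin n → Fin n → Fin n → Fin n → Set
Cross a b c d = (a < c × c < b × b < d) ⊎ (c < a × a < d × d < b)

EdgeIn : ∀ {n} → Subset n → Fin n → Fin n → Set
EdgeIn S a b = a < b × a ∈ S × b ∈ S

-- nonempty intersection of two complete geometric subgraphs: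
-- a shared vertex, or an edge of one crossing an edge of the other
Intersect : ∀ {n} → Subset n → Subset n → Set
Intersect {n} S T =
  (Σ (Fin n) λ v → v ∈ S × v ∈ T)
  ⊎ (Σ (Fin n) λ a → Σ (Fin n) λ b → Σ (Fin n) λ c → Σ (Fin n) λ d →
       EdgeIn S a b × EdgeIn T c d × Cross a b c d)

-- A decomposition [K^c_n , P]: a finite family of complete geometric
-- subgraphs (given by their vertex sets, each with at least one edge)
-- such that every edge of K^c_n lies in exactly one member.
record Decomposition (n : ℕ) : Set where
  field
    size        : ℕ
    part        : Fin size → Subset n
    nonempty    : ∀ p → 2 ≤ ∣ part p ∣
    covered     : ∀ a b → a < b → Σ (Fin size) λ p → EdgeIn (part p) a b
    unique      : ∀ a b p q → EdgeIn (part p) a b → EdgeIn (part q) a b → p ≡ q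

open Decomposition public

record Coloring {n : ℕ} (D : Decomposition n) (k : ℕ) : Set where
  field
    colour   : Fin n → Fin n → Fin k
    constant : ∀ p a b c d → EdgeIn (part D p) a b → EdgeIn (part D p) c d →
               colour a b ≡ colour c d
    proper   : ∀ p q → p ≢ q → Intersect (part D p) (part D q) →
               ∀ a b c d → EdgeIn (part D p) a b → EdgeIn (part D q) c d →
               colour a b ≢ colour c d

ChromaticIndex≥ : ∀ {n} → Decomposition n → ℕ → Set
ChromaticIndex≥ D m = ∀ k → Coloring D k → m ≤ k

-- Cut the 3m vertices of K^c_{3m} into three consecutive blocks A, B, C of m
-- vertices and fix a Latin square ⊕ on {0,…,m-1}.  The members of the
-- decomposition are the m² triangles {Aᵢ, Bⱼ, C_{i⊕j}} and the three blocks
-- themselves; the Latin property says that every edge between two blocks lies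
-- in exactly one triangle.  Any two triangles intersect (they share a vertex,
-- or two of their sides cross), so they form an intersecting family of size
-- m², and an intersecting family of s members needs s colours.  For
-- n = r + 3m with r ≤ 2 we prepend r vertices, each joined to every later
-- vertex by a single-edge member; this keeps the old members and their
-- intersections, and n² ≤ 9m² + 8n gives the theorem with constant 8 (for
-- m ≤ 1 we have n ≤ 8 and any decomposition will do).

module Submission where

open import Defs
open import Data.Nat using (ℕ; zero; suc; _+_; _*_; _∸_; _≤_; _≤?_; _<?_; s≤s; z<s; s≤s⁻¹)
import Data.Nat as ℕ
open import Data.Nat.Properties
  using (≤-trans; ≤-<-trans; <⇒≤; ≮⇒≥; ≰⇒>; +-comm; +-assoc; *-comm; +-commutativeSemigroup;
         +-cancelˡ-≡; +-cancelʳ-≡; +-cancelˡ-<; +-mono-<; +-monoˡ-<; +-monoʳ-<; +-mono-≤; +-monoˡ-≤;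
         +-monoʳ-≤; *-monoˡ-≤; *-monoʳ-≤; m+n≮n; m≤m+n; m≤n+m; m∸n≤m; m+[n∸m]≡n; m∸n+n≡m;
         module ≤-Reasoning)
open import Algebra.Properties.CommutativeSemigroup +-commutativeSemigroup using (x∙yz≈y∙xz)
open import Data.Nat.DivMod using (_%_; _/_; m%n<n; m≡m%n+[m/n]*n)
open import Data.Nat.Tactic.RingSolver using (solve-∀)
open import Data.Fin as Fin using (Fin; zero; suc; toℕ; fromℕ<; combine; remQuot; _≟_)
open import Data.Fin.Patterns using (0F; 1F; 2F)
open import Data.Fin.Properties
  using (suc-injective; toℕ<n; toℕ-fromℕ<; toℕ-injective; <-cmp; <-asym; <⇒≢; injective⇒≤; combine-monoˡ-<;
         combine-injective; combine-remQuot; remQuot-combine; toℕ-combine; +↔⊎; *↔×)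
open import Data.Fin.Subset using (Subset; _∈_; ∣_∣; ⁅_⁆; inside; outside)
open import Data.Fin.Subset.Properties
  using (x∈⁅x⁆; x∈⁅y⁆⇒x≡y; x≢y⇒x∉⁅y⁆; ∣⁅x⁆∣≡1; p⊂q⇒∣p∣<∣q∣)
open import Data.Vec using (_∷_; tabulate; here; there)
open import Data.Vec.Properties using (lookup∘tabulate; []=⇒lookup; lookup⇒[]=)
open import Data.Product using (Σ; _×_; _,_; proj₁; proj₂)
open import Data.Sum using (_⊎_; inj₁; inj₂)
open import Data.Sum.Properties using (inj₁-injective; inj₂-injective)
open import Data.Sum.Function.Propositional using (_⊎-↔_)
open import Function using (_∘_; _↔_; Inverse; Injection)
open import Function.Construct.Identity using (↔-id)
open import Function.Properties.Inverse using (↔-sym; ↔-trans; ↔⇒↣)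
open import Relation.Nullary using (¬_; Dec; yes; no; does; contradiction)
open import Relation.Nullary.Decidable using (dec-true)
open import Relation.Binary using (tri<; tri≈; tri>)
open import Relation.Binary.PropositionalEquality
  using (_≡_; _≢_; refl; sym; trans; cong; cong₂; subst; subst₂)

two-elements : ∀ {n} {S : Subset n} {x y : Fin n} → x ≢ y → x ∈ S → y ∈ S → 2 ≤ ∣ S ∣
two-elements {S = S} {x} {y} x≢y x∈S y∈S =
  subst (ℕ._< ∣ S ∣) (∣⁅x⁆∣≡1 x) (p⊂q⇒∣p∣<∣q∣ (⁅x⁆⊆S , y , y∈S , x≢y⇒x∉⁅y⁆ (x≢y ∘ sym)))
  where
  ⁅x⁆⊆S : ∀ {z} → z ∈ ⁅ x ⁆ → z ∈ S
  ⁅x⁆⊆S z∈⁅x⁆ = subst (_∈ S) (sym (x∈⁅y⁆⇒x≡y x z∈⁅x⁆)) x∈S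

subsetOf : ∀ {n} {P : Fin n → Set} → (∀ v → Dec (P v)) → Subset n
subsetOf P? = tabulate (does ∘ P?)

∈-subsetOf⁺ : ∀ {n} {P : Fin n → Set} (P? : ∀ v → Dec (P v)) {v} → P v → v ∈ subsetOf P?
∈-subsetOf⁺ P? {v} p = lookup⇒[]= v _ (trans (lookup∘tabulate (does ∘ P?) v) (dec-true (P? v) p))

∈-subsetOf⁻ : ∀ {n} {P : Fin n → Set} (P? : ∀ v → Dec (P v)) {v} → v ∈ subsetOf P? → P v
∈-subsetOf⁻ P? {v} v∈ with P? v | trans (sym (lookup∘tabulate (does ∘ P?) v)) ([]=⇒lookup v∈)
... | yes p | _ = p
... | no _ | ()

intersect-sym : ∀ {n} {S T : Subset n} → Intersect S T → Intersect T S
intersect-sym (inj₁ (v , v∈S , v∈T)) = inj₁ (v , v∈T , v∈S)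
intersect-sym (inj₂ (a , b , c , d , ab , cd , inj₁ x)) = inj₂ (c , d , a , b , cd , ab , inj₂ x)
intersect-sym (inj₂ (a , b , c , d , ab , cd , inj₂ x)) = inj₂ (c , d , a , b , cd , ab , inj₁ x)

record IntersectingFamily {n} {I : Set} (part : I → Subset n) (s : ℕ) : Set where
  field
    member   : Fin s → I
    distinct : ∀ {i j} → member i ≡ member j → i ≡ j
    source   : Fin s → Fin n
    target   : Fin s → Fin n
    edge     : ∀ i → EdgeIn (part (member i)) (source i) (target i)
    pairwise : ∀ i j → i ≢ j → Intersect (part (member i)) (part (member j))

family≤colours : ∀ {n s k} {D : Decomposition n} →
  IntersectingFamily (part D) s → Coloring D k → s ≤ k
family≤colours {s = s} {k} F C = injective⇒≤ {f = colourOf} colourOf-injective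
  where
  open IntersectingFamily F
  open Coloring C
  colourOf : Fin s → Fin k
  colourOf i = colour (source i) (target i)
  colourOf-injective : ∀ {i j} → colourOf i ≡ colourOf j → i ≡ j
  colourOf-injective {i} {j} same with i ≟ j
  ... | yes i≡j = i≡j
  ... | no i≢j = contradiction same
        (proper (member i) (member j) (i≢j ∘ distinct) (pairwise i j i≢j) _ _ _ _ (edge i) (edge j))

reindex-family : ∀ {n s} {I J : Set} {P : I → Subset n} {Q : J → Subset n} (g : I → J) →
  (∀ {x y} → g x ≡ g y → x ≡ y) → (∀ x → Q (g x) ≡ P x) →
  IntersectingFamily P s → IntersectingFamily Q s
reindex-family g g-injective same F = record
  { member   = g ∘ member
  ; distinct = distinct ∘ g-injective
  ; source   = source
  ; target   = target
  ; edge     = λ i → subst (λ S → EdgeIn S (source i) (target i)) (sym (same (member i))) (edge i)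
  ; pairwise = λ i j i≢j →
      subst₂ Intersect (sym (same (member i))) (sym (same (member j))) (pairwise i j i≢j)
  }
  where open IntersectingFamily F

record IndexedDecomposition (n : ℕ) (I : Set) : Set where
  field
    cell        : I → Subset n
    cell-size   : ∀ p → 2 ≤ ∣ cell p ∣
    cell-covers : ∀ a b → a Fin.< b → Σ I λ p → EdgeIn (cell p) a b
    cell-unique : ∀ a b p q → EdgeIn (cell p) a b → EdgeIn (cell q) a b → p ≡ q

open IndexedDecomposition

enumerate : ∀ {n s} {I : Set} → Fin s ↔ I → IndexedDecomposition n I → Decomposition n
enumerate {s = s} e D = record
  { size     = s
  ; part     = cell D ∘ to
  ; nonempty = cell-size D ∘ to
  ; covered  = λ a b a<b → let (p , ab) = cell-covers D a b a<b in
      from p , subst (λ S → EdgeIn S a b) (sym (cong (cell D) (strictlyInverseˡ p))) ab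
  ; unique   = λ a b p q ab ab′ → Injection.injective (↔⇒↣ e) (cell-unique D a b _ _ ab ab′)
  }
  where open Inverse e

enumerate-family : ∀ {n s t} {I : Set} (e : Fin s ↔ I) (D : IndexedDecomposition n I) →
  IntersectingFamily (cell D) t → IntersectingFamily (part (enumerate e D)) t
enumerate-family e D =
  reindex-family from (Injection.injective (↔⇒↣ (↔-sym e))) (cong (cell D) ∘ strictlyInverseˡ)
  where open Inverse e

shift-edge : ∀ {n} {S : Subset n} {a b} x → EdgeIn S a b → EdgeIn (x ∷ S) (suc a) (suc b)
shift-edge _ (a<b , a∈S , b∈S) = s≤s a<b , there a∈S , there b∈S

shift-intersect : ∀ {n} {S T : Subset n} x y → Intersect S T → Intersect (x ∷ S) (y ∷ T)
shift-intersect _ _ (inj₁ (v , v∈S , v∈T)) = inj₁ (suc v , there v∈S , there v∈T)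
shift-intersect x y (inj₂ (a , b , c , d , ab , cd , cross)) =
  inj₂ (suc a , suc b , suc c , suc d , shift-edge x ab , shift-edge y cd , shift-cross cross)
  where
  shift-cross : Cross a b c d → Cross (suc a) (suc b) (suc c) (suc d)
  shift-cross (inj₁ (a<c , c<b , b<d)) = inj₁ (s≤s a<c , s≤s c<b , s≤s b<d)
  shift-cross (inj₂ (c<a , a<d , d<b)) = inj₂ (s≤s c<a , s≤s a<d , s≤s d<b)

shift-family : ∀ {n s} {I : Set} {P : I → Subset n} →
  IntersectingFamily P s → IntersectingFamily (λ p → outside ∷ P p) s
shift-family F = record
  { member   = member
  ; distinct = distinct
  ; source   = suc ∘ source
  ; target   = suc ∘ target
  ; edge     = shift-edge outside ∘ edge
  ; pairwise = λ i j i≢j → shift-intersect outside outside (pairwise i j i≢j)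
  }
  where open IntersectingFamily F

-- Adding a new vertex 0 to a decomposition of K^c_n: its n edges become
-- single-edge members ("stars"), the old members are shifted by one.
module AddVertex {n} (D : Decomposition n) where

  star : Fin n → Subset (suc n)
  star x = inside ∷ ⁅ x ⁆

  star-edge : ∀ {x a b} → EdgeIn (star x) a b → a ≡ zero × b ≡ suc x
  star-edge {x} {zero} {suc b} (_ , _ , there b∈⁅x⁆) = refl , cong suc (x∈⁅y⁆⇒x≡y x b∈⁅x⁆)
  star-edge {x} {suc a} {suc b} (s≤s a<b , there a∈⁅x⁆ , there b∈⁅x⁆) =
    contradiction (trans (x∈⁅y⁆⇒x≡y x a∈⁅x⁆) (sym (x∈⁅y⁆⇒x≡y x b∈⁅x⁆))) (<⇒≢ a<b)

  members : Fin n ⊎ Fin (size D) → Subset (suc n)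
  members (inj₁ x) = star x
  members (inj₂ p) = outside ∷ part D p

  members-size : ∀ p → 2 ≤ ∣ members p ∣
  members-size (inj₁ x) = two-elements {x = zero} {suc x} (λ ()) here (there (x∈⁅x⁆ x))
  members-size (inj₂ p) = nonempty D p

  members-cover : ∀ a b → a Fin.< b → Σ (Fin n ⊎ Fin (size D)) λ p → EdgeIn (members p) a b
  members-cover zero    (suc b) a<b       = inj₁ b , a<b , here , there (x∈⁅x⁆ b)
  members-cover (suc a) (suc b) (s≤s a<b) =
    let (p , ab) = covered D a b a<b in inj₂ p , shift-edge outside ab

  -- a star edge starts at 0, which no shifted member contains
  members-unique : ∀ a b p q → EdgeIn (members p) a b → EdgeIn (members q) a b → p ≡ q
  members-unique a b (inj₁ x) (inj₁ y) ab ab′ =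
    cong inj₁ (suc-injective (trans (sym (proj₂ (star-edge ab))) (proj₂ (star-edge ab′))))
  members-unique a b (inj₁ x) (inj₂ q) ab _ with star-edge ab
  members-unique _ b (inj₁ x) (inj₂ q) ab (_ , () , _) | refl , _
  members-unique a b (inj₂ p) (inj₁ y) _ ab′ with star-edge ab′
  members-unique _ b (inj₂ p) (inj₁ y) (_ , () , _) ab′ | refl , _
  members-unique (suc a) (suc b) (inj₂ p) (inj₂ q)
                 (s≤s a<b , there a∈p , there b∈p) (s≤s a<b′ , there a∈q , there b∈q) =
    cong inj₂ (unique D a b p q (a<b , a∈p , b∈p) (a<b′ , a∈q , b∈q))

  extended : IndexedDecomposition (suc n) (Fin n ⊎ Fin (size D))
  extended = record
    { cell = members ; cell-size = members-size ; cell-covers = members-cover ; cell-unique = members-unique }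

addVertex : ∀ {n} → Decomposition n → Decomposition (suc n)
addVertex D = enumerate +↔⊎ (AddVertex.extended D)

addVertex-family : ∀ {n s} (D : Decomposition n) →
  IntersectingFamily (part D) s → IntersectingFamily (part (addVertex D)) s
addVertex-family D F =
  enumerate-family +↔⊎ (AddVertex.extended D) (reindex-family inj₂ inj₂-injective (λ _ → refl) (shift-family F))

addVertices : ∀ r {n} → Decomposition n → Decomposition (r + n)
addVertices zero    D = D
addVertices (suc r) D = addVertex (addVertices r D)

addVertices-family : ∀ r {n s} (D : Decomposition n) →
  IntersectingFamily (part D) s → IntersectingFamily (part (addVertices r D)) s
addVertices-family zero    D F = F
addVertices-family (suc r) D F = addVertex-family (addVertices r D) (addVertices-family r D F)

singleEdges : ∀ n → Decomposition n
singleEdges zero    = record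
  { size = 0 ; part = λ () ; nonempty = λ () ; covered = λ () ; unique = λ () }
singleEdges (suc n) = addVertex (singleEdges n)

record LatinSquare (m : ℕ) : Set where
  infixl 6 _⊕_
  field
    _⊕_     : Fin m → Fin m → Fin m
    cancelˡ : ∀ {i i′ j} → i ⊕ j ≡ i′ ⊕ j → i ≡ i′
    cancelʳ : ∀ {i j j′} → i ⊕ j ≡ i ⊕ j′ → j ≡ j′
    solveˡ  : ∀ j k → Σ (Fin m) λ i → i ⊕ j ≡ k
    solveʳ  : ∀ i k → Σ (Fin m) λ j → i ⊕ j ≡ k

-- Wrap m i j k: k is i + j reduced modulo m; for residues i, j, k < m at most
-- one subtraction of m is needed.
Wrap : ℕ → ℕ → ℕ → ℕ → Set
Wrap m i j k = i + j ≡ k ⊎ i + j ≡ k + m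

wrap-comm : ∀ {m i j k} → Wrap m i j k → Wrap m j i k
wrap-comm {i = i} {j} (inj₁ e) = inj₁ (trans (+-comm j i) e)
wrap-comm {i = i} {j} (inj₂ e) = inj₂ (trans (+-comm j i) e)

residue≢wrapped : ∀ {m k k′} → k ℕ.< m → k ≢ k′ + m
residue≢wrapped {m} {k′ = k′} k<m k≡k′+m = m+n≮n k′ m (subst (ℕ._< m) k≡k′+m k<m)

wrap-exists : ∀ {m i j} → i ℕ.< m → j ℕ.< m → Σ ℕ λ k → k ℕ.< m × Wrap m i j k
wrap-exists {m} {i} {j} i<m j<m with i + j <? m
... | yes s<m = i + j , s<m , inj₁ refl
... | no s≮m = i + j ∸ m , k<m , inj₂ (sym (m∸n+n≡m (≮⇒≥ s≮m)))
  where
  k<m : i + j ∸ m ℕ.< m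
  k<m = +-cancelˡ-< m _ m (subst (ℕ._< m + m) (sym (m+[n∸m]≡n (≮⇒≥ s≮m))) (+-mono-< i<m j<m))

wrap-unique : ∀ {m i j k k′} → k ℕ.< m → k′ ℕ.< m → Wrap m i j k → Wrap m i j k′ → k ≡ k′
wrap-unique _    _     (inj₁ e) (inj₁ e′) = trans (sym e) e′
wrap-unique k<m  _     (inj₁ e) (inj₂ e′) = contradiction (trans (sym e) e′) (residue≢wrapped k<m)
wrap-unique _    k′<m  (inj₂ e) (inj₁ e′) = contradiction (trans (sym e′) e) (residue≢wrapped k′<m)
wrap-unique _    _     (inj₂ e) (inj₂ e′) = +-cancelʳ-≡ _ _ _ (trans (sym e) e′)

wrapped-summand : ∀ {m i j j′ k} → i + j ≡ k → i + j′ ≡ k + m → j′ ≡ j + m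
wrapped-summand {m} {i} {j} e e′ =
  +-cancelˡ-≡ i _ _ (trans e′ (trans (cong (_+ m) (sym e)) (+-assoc i j m)))

wrap-cancel : ∀ {m i j j′ k} → j ℕ.< m → j′ ℕ.< m → Wrap m i j k → Wrap m i j′ k → j ≡ j′
wrap-cancel {i = i} _ _ (inj₁ e) (inj₁ e′) = +-cancelˡ-≡ i _ _ (trans e (sym e′))
wrap-cancel {i = i} _ _ (inj₂ e) (inj₂ e′) = +-cancelˡ-≡ i _ _ (trans e (sym e′))
wrap-cancel _ j′<m (inj₁ e) (inj₂ e′) = contradiction (wrapped-summand e e′) (residue≢wrapped j′<m)
wrap-cancel j<m _  (inj₂ e) (inj₁ e′) = contradiction (wrapped-summand e′ e) (residue≢wrapped j<m)

wrap-solve : ∀ {m i k} → i ℕ.< m → k ℕ.< m → Σ ℕ λ j → j ℕ.< m × Wrap m i j k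
wrap-solve {m} {i} {k} i<m k<m with i ≤? k
... | yes i≤k = k ∸ i , ≤-<-trans (m∸n≤m k i) k<m , inj₁ (m+[n∸m]≡n i≤k)
... | no i≰k = k + (m ∸ i) , j<m , inj₂ sum
  where
  i+[m∸i]≡m : i + (m ∸ i) ≡ m
  i+[m∸i]≡m = m+[n∸m]≡n (<⇒≤ i<m)
  j<m : k + (m ∸ i) ℕ.< m
  j<m = subst (k + (m ∸ i) ℕ.<_) i+[m∸i]≡m (+-monoˡ-< (m ∸ i) (≰⇒> i≰k))
  sum : i + (k + (m ∸ i)) ≡ k + m
  sum = trans (x∙yz≈y∙xz i k (m ∸ i)) (cong (k +_) i+[m∸i]≡m)

residue : ∀ {m} (P : ℕ → Set) → Σ ℕ (λ k → k ℕ.< m × P k) → Σ (Fin m) (P ∘ toℕ)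
residue P (k , k<m , p) = fromℕ< k<m , subst P (sym (toℕ-fromℕ< k<m)) p

cyclic : ∀ m → LatinSquare m
cyclic m = record { _⊕_ = _⊕_ ; cancelˡ = cancelˡ ; cancelʳ = cancelʳ ; solveˡ = solveˡ ; solveʳ = solveʳ }
  where
  infixl 6 _⊕_
  _⊕_ : Fin m → Fin m → Fin m
  i ⊕ j = proj₁ (residue (Wrap m (toℕ i) (toℕ j)) (wrap-exists (toℕ<n i) (toℕ<n j)))

  ⊕-wrap : ∀ i j → Wrap m (toℕ i) (toℕ j) (toℕ (i ⊕ j))
  ⊕-wrap i j = proj₂ (residue (Wrap m (toℕ i) (toℕ j)) (wrap-exists (toℕ<n i) (toℕ<n j)))

  ⊕-unique : ∀ {i j k} → Wrap m (toℕ i) (toℕ j) (toℕ k) → i ⊕ j ≡ k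
  ⊕-unique {i} {j} {k} w = toℕ-injective (wrap-unique {i = toℕ i} {toℕ j} (toℕ<n (i ⊕ j)) (toℕ<n k) (⊕-wrap i j) w)

  ⊕-comm : ∀ i j → i ⊕ j ≡ j ⊕ i
  ⊕-comm i j = ⊕-unique (wrap-comm {i = toℕ j} {toℕ i} (⊕-wrap j i))

  cancelʳ : ∀ {i j j′} → i ⊕ j ≡ i ⊕ j′ → j ≡ j′
  cancelʳ {i} {j} {j′} e = toℕ-injective (wrap-cancel {i = toℕ i} (toℕ<n j) (toℕ<n j′) (⊕-wrap i j)
    (subst (Wrap m (toℕ i) (toℕ j′) ∘ toℕ) (sym e) (⊕-wrap i j′)))

  cancelˡ : ∀ {i i′ j} → i ⊕ j ≡ i′ ⊕ j → i ≡ i′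
  cancelˡ {i} {i′} {j} e = cancelʳ (trans (⊕-comm j i) (trans e (⊕-comm i′ j)))

  solveʳ : ∀ i k → Σ (Fin m) λ j → i ⊕ j ≡ k
  solveʳ i k =
    let (j , w) = residue (λ j → Wrap m (toℕ i) j (toℕ k)) (wrap-solve (toℕ<n i) (toℕ<n k))
    in j , ⊕-unique w

  solveˡ : ∀ j k → Σ (Fin m) λ i → i ⊕ j ≡ k
  solveˡ j k = let (i , e) = solveʳ j k in i , trans (⊕-comm i j) e

two-distinct : ∀ {m} → 2 ≤ m → Σ (Fin m) λ o → Σ (Fin m) λ o′ → o ≢ o′
two-distinct (s≤s (s≤s _)) = zero , suc zero , λ ()

crossing : ∀ {n} {S T : Subset n} {a b c d} → EdgeIn S a b → EdgeIn T c d → Cross a b c d → Intersect S T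
crossing ab cd cross = inj₂ (_ , _ , _ , _ , ab , cd , cross)

-- The triangle decomposition of K^c_{3m} built from a Latin square (m ≥ 2).
-- ⟨ β , o ⟩ is vertex o of block β, the blocks A, B, C being 0, 1, 2.
module Triangles {m} (L : LatinSquare m) (m≥2 : 2 ≤ m) where
  open LatinSquare L

  Vertex : Set
  Vertex = Fin (3 * m)

  Position : Set
  Position = Fin 3 × Fin m

  ⟨_,_⟩ : Fin 3 → Fin m → Vertex
  ⟨ β , o ⟩ = combine β o

  position : Vertex → Position
  position = remQuot m

  position-injective : ∀ {a b} → position a ≡ position b → a ≡ b
  position-injective = Injection.injective (↔⇒↣ *↔×)

  A<B : Fin._<_ {3} {3} 0F 1F
  A<B = z<s
  A<C : Fin._<_ {3} {3} 0F 2F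
  A<C = z<s
  B<C : Fin._<_ {3} {3} 1F 2F
  B<C = s≤s z<s

  <-block : ∀ {β β′ o o′} → β Fin.< β′ → ⟨ β , o ⟩ Fin.< ⟨ β′ , o′ ⟩
  <-block {o = o} {o′} = combine-monoˡ-< o o′

  <-offset : ∀ β {o o′} → o Fin.< o′ → ⟨ β , o ⟩ Fin.< ⟨ β , o′ ⟩
  <-offset β {o} {o′} o<o′ = subst₂ ℕ._<_ (sym (toℕ-combine β o)) (sym (toℕ-combine β o′))
    (+-monoʳ-< (m * toℕ β) o<o′)

  block-order : ∀ {a b} → a Fin.< b → ¬ (proj₁ (position b) Fin.< proj₁ (position a))
  block-order {a} {b} a<b later =
    <-asym a<b (subst₂ Fin._<_ (combine-remQuot {3} m b) (combine-remQuot {3} m a) (<-block later))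

  -- Members: a triangle (i , j) with corners Aᵢ, Bⱼ, C_{i⊕j}, or a whole block.
  Cell : Set
  Cell = (Fin m × Fin m) ⊎ Fin 3

  corner : Fin m × Fin m → Fin 3 → Fin m
  corner (i , j) 0F = i
  corner (i , j) 1F = j
  corner (i , j) 2F = i ⊕ j

  Contains : Cell → Position → Set
  Contains (inj₁ t) (β , o) = o ≡ corner t β
  Contains (inj₂ γ) (β , o) = β ≡ γ

  contains? : ∀ u x → Dec (Contains u x)
  contains? (inj₁ t) (β , o) = o ≟ corner t β
  contains? (inj₂ γ) (β , o) = β ≟ γ

  vertices : Cell → Subset (3 * m)
  vertices u = subsetOf (contains? u ∘ position)

  ⟨⟩∈vertices : ∀ u {β o} → Contains u (β , o) → ⟨ β , o ⟩ ∈ vertices u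
  ⟨⟩∈vertices u {β} {o} c =
    ∈-subsetOf⁺ (contains? u ∘ position) (subst (Contains u) (sym (remQuot-combine β o)) c)

  cornerVertex : Fin m × Fin m → Fin 3 → Vertex
  cornerVertex t β = ⟨ β , corner t β ⟩

  corner∈ : ∀ t β → cornerVertex t β ∈ vertices (inj₁ t)
  corner∈ t β = ⟨⟩∈vertices (inj₁ t) {β} refl

  vertices-size : ∀ u → 2 ≤ ∣ vertices u ∣
  vertices-size (inj₁ t) = two-elements (<⇒≢ (<-block A<B)) (corner∈ t 0F) (corner∈ t 1F)
  vertices-size (inj₂ β) =
    let (o , o′ , o≢o′) = two-distinct m≥2 in
    two-elements (o≢o′ ∘ proj₂ ∘ combine-injective β o β o′)
                 (⟨⟩∈vertices (inj₂ β) {β} {o} refl) (⟨⟩∈vertices (inj₂ β) {β} {o′} refl)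

  -- Two positions, the second not in an earlier block, have a common cell:
  -- the block if they share it, otherwise the triangle given by the Latin square.
  common-cell : ∀ x y → ¬ (proj₁ y Fin.< proj₁ x) → Σ Cell λ u → Contains u x × Contains u y
  common-cell (0F , _) (0F , _) _ = inj₂ 0F , refl , refl
  common-cell (1F , _) (1F , _) _ = inj₂ 1F , refl , refl
  common-cell (2F , _) (2F , _) _ = inj₂ 2F , refl , refl
  common-cell (0F , i) (1F , j) _ = inj₁ (i , j) , refl , refl
  common-cell (0F , i) (2F , k) _ = let (j , i⊕j≡k) = solveʳ i k in inj₁ (i , j) , refl , sym i⊕j≡k
  common-cell (1F , j) (2F , k) _ = let (i , i⊕j≡k) = solveˡ j k in inj₁ (i , j) , refl , sym i⊕j≡k
  common-cell (1F , _) (0F , _) later = contradiction A<B later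
  common-cell (2F , _) (0F , _) later = contradiction A<C later
  common-cell (2F , _) (1F , _) later = contradiction B<C later

  one-corner-per-block : ∀ t {x y} → Contains (inj₁ t) x → Contains (inj₁ t) y → proj₁ x ≡ proj₁ y → x ≡ y
  one-corner-per-block t {β , o} {.β , o′} tx ty refl = cong (β ,_) (trans tx (sym ty))

  triangle-determined : ∀ {β β′} t t′ → β ≢ β′ →
    corner t β ≡ corner t′ β → corner t β′ ≡ corner t′ β′ → t ≡ t′
  triangle-determined {0F} {0F} _ _ β≢β′ _ _ = contradiction refl β≢β′
  triangle-determined {1F} {1F} _ _ β≢β′ _ _ = contradiction refl β≢β′
  triangle-determined {2F} {2F} _ _ β≢β′ _ _ = contradiction refl β≢β′
  triangle-determined {0F} {1F} _ _ _ i≡i′ j≡j′ = cong₂ _,_ i≡i′ j≡j′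
  triangle-determined {1F} {0F} _ _ _ j≡j′ i≡i′ = cong₂ _,_ i≡i′ j≡j′
  triangle-determined {0F} {2F} (i , j) (i′ , j′) _ i≡i′ k≡k′ =
    cong₂ _,_ i≡i′ (cancelʳ (trans k≡k′ (cong (_⊕ j′) (sym i≡i′))))
  triangle-determined {2F} {0F} (i , j) (i′ , j′) _ k≡k′ i≡i′ =
    cong₂ _,_ i≡i′ (cancelʳ (trans k≡k′ (cong (_⊕ j′) (sym i≡i′))))
  triangle-determined {1F} {2F} (i , j) (i′ , j′) _ j≡j′ k≡k′ =
    cong₂ _,_ (cancelˡ (trans k≡k′ (cong (i′ ⊕_) (sym j≡j′)))) j≡j′
  triangle-determined {2F} {1F} (i , j) (i′ , j′) _ k≡k′ j≡j′ =
    cong₂ _,_ (cancelˡ (trans k≡k′ (cong (i′ ⊕_) (sym j≡j′)))) j≡j′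

  common-cell-unique : ∀ {x y} u v → x ≢ y →
    Contains u x → Contains u y → Contains v x → Contains v y → u ≡ v
  common-cell-unique (inj₂ γ) (inj₂ δ) _ ux _ vx _ = cong inj₂ (trans (sym ux) vx)
  common-cell-unique (inj₁ t) (inj₂ δ) x≢y ux uy vx vy =
    contradiction (one-corner-per-block t ux uy (trans vx (sym vy))) x≢y
  common-cell-unique (inj₂ γ) (inj₁ t) x≢y ux uy vx vy =
    contradiction (one-corner-per-block t vx vy (trans ux (sym uy))) x≢y
  common-cell-unique {β , _} {β′ , _} (inj₁ t) (inj₁ t′) x≢y ux uy vx vy with β ≟ β′
  ... | yes β≡β′ = contradiction (one-corner-per-block t ux uy β≡β′) x≢y
  ... | no β≢β′ = cong inj₁ (triangle-determined t t′ β≢β′ (trans (sym ux) vx) (trans (sym uy) vy))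

  cells : IndexedDecomposition (3 * m) Cell
  cells = record
    { cell        = vertices
    ; cell-size   = vertices-size
    ; cell-covers = λ a b a<b →
        let (u , ua , ub) = common-cell (position a) (position b) (block-order a<b) in
        u , a<b , ∈-subsetOf⁺ (contains? u ∘ position) ua , ∈-subsetOf⁺ (contains? u ∘ position) ub
    ; cell-unique = λ a b u v (a<b , a∈u , b∈u) (_ , a∈v , b∈v) →
        common-cell-unique u v (<⇒≢ a<b ∘ position-injective)
          (∈-subsetOf⁻ (contains? u ∘ position) a∈u) (∈-subsetOf⁻ (contains? u ∘ position) b∈u)
          (∈-subsetOf⁻ (contains? v ∘ position) a∈v) (∈-subsetOf⁻ (contains? v ∘ position) b∈v)
    }

  side : ∀ t {β β′} → β Fin.< β′ → EdgeIn (vertices (inj₁ t)) (cornerVertex t β) (cornerVertex t β′)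
  side t {β} {β′} β<β′ = <-block β<β′ , corner∈ t β , corner∈ t β′

  shared-corner : ∀ t t′ β → corner t β ≡ corner t′ β → Intersect (vertices (inj₁ t)) (vertices (inj₁ t′))
  shared-corner t t′ β e =
    inj₁ (cornerVertex t β , corner∈ t β , subst (λ o → ⟨ β , o ⟩ ∈ vertices (inj₁ t′)) (sym e) (corner∈ t′ β))

  parallel-cross : ∀ {β β′ o₁ o₁′ o₂ o₂′} → β Fin.< β′ → o₁ Fin.< o₂ → o₁′ Fin.< o₂′ →
    Cross ⟨ β , o₁ ⟩ ⟨ β′ , o₁′ ⟩ ⟨ β , o₂ ⟩ ⟨ β′ , o₂′ ⟩
  parallel-cross {β} {β′} β<β′ o₁<o₂ o₁′<o₂′ = inj₁ (<-offset β o₁<o₂ , <-block β<β′ , <-offset β′ o₁′<o₂′)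

  -- If Aᵢ < Aᵢ′, then either the B-corners or the C-corners coincide, or
  -- AᵢBⱼ crosses Aᵢ′Bⱼ′ (j < j′), or AᵢC_k crosses Aᵢ′C_k′ (k < k′), or else
  -- BⱼC_k crosses Aᵢ′C_k′ (k > k′).
  ordered-triangles-intersect : ∀ t t′ → corner t 0F Fin.< corner t′ 0F →
    Intersect (vertices (inj₁ t)) (vertices (inj₁ t′))
  ordered-triangles-intersect t t′ i<i′ with <-cmp (corner t 1F) (corner t′ 1F) | <-cmp (corner t 2F) (corner t′ 2F)
  ... | tri≈ _ j≡j′ _ | _              = shared-corner t t′ 1F j≡j′
  ... | tri< j<j′ _ _ | _              = crossing (side t A<B) (side t′ A<B) (parallel-cross A<B i<i′ j<j′)
  ... | tri> _ _ _    | tri≈ _ k≡k′ _  = shared-corner t t′ 2F k≡k′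
  ... | tri> _ _ _    | tri< k<k′ _ _  = crossing (side t A<C) (side t′ A<C) (parallel-cross A<C i<i′ k<k′)
  ... | tri> _ _ _    | tri> _ _ k′<k  =
    crossing (side t B<C) (side t′ A<C) (inj₂ (<-block A<B , <-block B<C , <-offset 2F k′<k))

  triangles-intersect : ∀ t t′ → Intersect (vertices (inj₁ t)) (vertices (inj₁ t′))
  triangles-intersect t t′ with <-cmp (corner t 0F) (corner t′ 0F)
  ... | tri≈ _ i≡i′ _ = shared-corner t t′ 0F i≡i′
  ... | tri< i<i′ _ _ = ordered-triangles-intersect t t′ i<i′
  ... | tri> _ _ i′<i = intersect-sym (ordered-triangles-intersect t′ t i′<i)

  triangle-family : IntersectingFamily vertices (m * m)
  triangle-family = record
    { member   = inj₁ ∘ remQuot m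
    ; distinct = Injection.injective (↔⇒↣ *↔×) ∘ inj₁-injective
    ; source   = λ k → cornerVertex (remQuot m k) 0F
    ; target   = λ k → cornerVertex (remQuot m k) 1F
    ; edge     = λ k → side (remQuot m k) A<B
    ; pairwise = λ k k′ _ → triangles-intersect (remQuot m k) (remQuot m k′)
    }

  numbering : Fin (m * m + 3) ↔ Cell
  numbering = ↔-trans +↔⊎ (*↔× ⊎-↔ ↔-id _)

  decomposition : Decomposition (3 * m)
  decomposition = enumerate numbering cells

  decomposition-family : IntersectingFamily (part decomposition) (m * m)
  decomposition-family = enumerate-family numbering cells triangle-family

divide-by-3 : ∀ n → Σ ℕ λ r → Σ ℕ λ m → r ≤ 2 × n ≡ r + 3 * m
divide-by-3 n = n % 3 , n / 3 , s≤s⁻¹ (m%n<n n 3) ,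
  trans (m≡m%n+[m/n]*n n 3) (cong (n % 3 +_) (*-comm (n / 3) 3))

square-bound : ∀ r m → r ≤ 2 → (r + 3 * m) * (r + 3 * m) ≤ 9 * (m * m) + 8 * (r + 3 * m)
square-bound r m r≤2 = begin
  (r + 3 * m) * (r + 3 * m)                     ≡⟨ expand r m ⟩
  9 * (m * m) + r * (r + 6 * m)                 ≤⟨ +-monoʳ-≤ (9 * (m * m)) (*-monoˡ-≤ (r + 6 * m) r≤2) ⟩
  9 * (m * m) + 2 * (r + 6 * m)                 ≤⟨ +-monoʳ-≤ (9 * (m * m)) (m≤m+n (2 * (r + 6 * m)) (6 * r + 12 * m)) ⟩
  9 * (m * m) + (2 * (r + 6 * m) + (6 * r + 12 * m)) ≡⟨ cong (9 * (m * m) +_) (regroup r m) ⟩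
  9 * (m * m) + 8 * (r + 3 * m)                 ∎
  where
  open ≤-Reasoning
  expand : ∀ r m → (r + 3 * m) * (r + 3 * m) ≡ 9 * (m * m) + r * (r + 6 * m)
  expand = solve-∀
  regroup : ∀ r m → 2 * (r + 6 * m) + (6 * r + 12 * m) ≡ 8 * (r + 3 * m)
  regroup = solve-∀

small-bound : ∀ n k → n ≤ 8 → n * n ≤ 9 * k + 8 * n
small-bound n k n≤8 = ≤-trans (*-monoˡ-≤ n n≤8) (m≤n+m (8 * n) (9 * k))

theorem3p1 : Σ ℕ λ C → (n : ℕ) → Σ (Decomposition n) λ D →
    ∀ k → Coloring D k → n * n ≤ 9 * k + C * n
theorem3p1 = 8 , decomposition
  where
  decomposition : (n : ℕ) → Σ (Decomposition n) λ D → ∀ k → Coloring D k → n * n ≤ 9 * k + 8 * n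
  decomposition n with divide-by-3 n
  ... | r , m , r≤2 , refl with m ≤? 1
  ...   | yes m≤1 = singleEdges _ , λ k _ →
          small-bound (r + 3 * m) k (≤-trans (+-mono-≤ r≤2 (*-monoʳ-≤ 3 m≤1)) (m≤m+n 5 3))
  ...   | no m≰1 = addVertices r (Triangles.decomposition L m≥2) , λ k colouring → begin
          (r + 3 * m) * (r + 3 * m)       ≤⟨ square-bound r m r≤2 ⟩
          9 * (m * m) + 8 * (r + 3 * m)   ≤⟨ +-monoˡ-≤ (8 * (r + 3 * m)) (*-monoʳ-≤ 9 (m²≤k k colouring)) ⟩
          9 * k + 8 * (r + 3 * m)         ∎
    where
    open ≤-Reasoning
    L = cyclic m
    m≥2 = ≰⇒> m≰1
    m²≤k : ∀ k → Coloring (addVertices r (Triangles.decomposition L m≥2)) k → m * m ≤ k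
    m²≤k k = family≤colours (addVertices-family r _ (Triangles.decomposition-family L m≥2))
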